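{- Let $\mathcal{R}$ be any rule set with $\{(\Box,\Box),(\Box,\ast)\}\subseteq\mathcal{R}$ and write $\vdash$ for $\vdash^{\mathcal R}$ of the $\mathfrak{f}$-cube. Then: (1)(a) $\gamma^{z_3}\Vdash F\,\overline{\in}\{S\to S\}$; (b) $\gamma^{z_3}\Vdash G\,\overline{\in}\{Q\to M\}$; (c) $\gamma^{z_2}\Vdash O\,\overline{\in}\{\Pi\delta^{z_3}.(z_2\,B\,A)\}$. (2) $\delta^y\vdash T:E:\ast$. (3) $\delta^y\vdash J:D:\ast$. (4)(a) $\delta^y,\delta^{z_2},\delta^o\vdash (o\,P_{i,3}):(z_2\,E_i\,D_i):\ast$ for $i\in\{1,2,3\}$; (b) $\delta^y,\delta^{z_2},\delta^o\vdash (o\,P_{1,3})(o\,P_{2,3})(o\,P_{3,3}):C:\ast$; (c) $\delta^y\vdash V:R:\ast$. (5)(a) $\delta^y,\delta^h,\delta^r\vdash (r\,P_{i,2}):R_i:\ast$ for $i\in\{1,2\}$; (b) $\delta^y,\delta^h,\delta^r\vdash (r\,P_{1,2}\,T):C_1:\ast$; (c) $\delta^y,\delta^h,\delta^r\vdash (r\,P_{2,2}\,J):C_2:\ast$. (6) $\delta^y,\delta^h,\delta^r\vdash L:y:\ast$ and $\delta^y,\delta^h\vdash\lambda\delta^r.L:\Pi\delta^r.y:\ast$. (7) $\delta^y,\delta^h\vdash U:y:\ast$.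
   Context: Sorts $\ast,\Box$; variables $x^\varsigma$ are marked with a sort. Terms: $X::=\ast\mid\Box\mid x\mid \pi\,x\rho{:}X.\,Y\mid X\,Y$ with $\pi\in\{\lambda,\Pi\}$ and restriction $\rho=\overline{\in}\{X_1,\dots,X_i\}$, $i\ge0$; $\diamond=\overline{\in}\{\}$, and $x\diamond{:}X$ is written $x{:}X$. Contexts are finite sequences of declarations $x\rho{:}X$; $\mathrm{rdec}(\Delta)$ is the sequence of pairs $x\rho$ for declarations of $\Delta$ with $\rho\neq\diamond$. $\beta$ is the compatible closure of $(\lambda x\rho{:}X.Y)Z\to Y[x:=Z]$; $=_\beta$ its equivalence closure. Restriction satisfaction $\Gamma\Vdash Y\rho$: (ref) $\varepsilon\Vdash Y\,\overline{\in}\{X_1,\dots,X_n\}$ if $Y=_\beta X_i$ for some $i$; (ctR) if $x\notin\mathrm{dom}(\Gamma)$ and for all $i\in1..n$, $\Gamma[x:=X_i]\Vdash Y[x:=X_i]\,\rho[x:=X_i]$, then $(x\,\overline{\in}\{X_1,\dots,X_n\}),\Gamma\Vdash Y\rho$. Typing rules of $\vdash^{\mathcal R}$ ($\mathcal R$ a set of pairs of sorts containing $(\ast,\ast)$): (axiom) $\varepsilon\vdash\ast:\Box$; (weak) from $\Delta,\delta\vdash X:Y$ and $\Delta\vdash Z:W$ infer $\Delta,\delta\vdash Z:W$; (start) if $x^\varsigma\notin\mathrm{dom}(\Delta)$, $\Delta\vdash X:\varsigma$ and, for $\rho=\overline{\in}\{Y_1,\dots,Y_n\}$, $\Delta\vdash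 Y_j:X$ for all $j$, then $\Delta,x^\varsigma\rho{:}X\vdash x^\varsigma:X$; ($\Pi$) from $\Delta,x\rho{:}X\vdash Y:\varsigma$, $\Delta\vdash X:\varsigma'$, $(\varsigma',\varsigma)\in\mathcal R$ infer $\Delta\vdash\Pi x\rho{:}X.Y:\varsigma$; ($\lambda$) from $\Delta,\delta\vdash Y':Y$ and $\Delta\vdash\Pi\delta.Y:\varsigma$ infer $\Delta\vdash\lambda\delta.Y':\Pi\delta.Y$; (app) from $\Delta\vdash Z:\Pi x\rho{:}X.Y$, $\Delta\vdash W:X$ and (if $\rho\ne\diamond$) $\mathrm{rdec}(\Delta)\Vdash W\rho$ infer $\Delta\vdash ZW:Y[x:=W]$; (conv) from $\Delta\vdash X:Y$, $\Delta\vdash Z:\varsigma$, $\mathrm{rdec}(\Delta)\Vdash Y\,\overline{\in}\{Z\}$ infer $\Delta\vdash X:Z$. $\Delta\vdash X:Y:Z$ means both $\Delta\vdash X:Y$ and $\Delta\vdash Y:Z$. Degree: $\sharp(\Box)=3,\sharp(\ast)=2,\sharp(x^\varsigma)=\sharp(\varsigma)-2$, $\sharp(\pi\delta.X)=\sharp(XY)=\sharp(X)$. $X\to Y=\Pi w^\varsigma{:}X.Y$ ($w$ not free in $Y$; $\varsigma=\ast$ if $\sharp(X)=1$, $\varsigma=\Box$ if $\sharp(X)=2$), right-associative. $\ast_0=\ast$, $\ast_{i+1}=\ast\to\ast_i$. $\delta^y=y^\Box{:}\ast$; $\delta^{x_i}=x_i^\Box{:}\ast$; $P_{i,q}=\lambda\delta^{x_1}.\cdots.\lambda\delta^{x_q}.x_i$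 ($i\in1..q$); $\delta^{z_q}=z_q^\Box\,\overline{\in}\{P_{1,q},\dots,P_{q,q}\}{:}\ast_q$ and $\gamma^{z_q}$ is the restricted declaration $z_q\,\overline{\in}\{P_{1,q},\dots,P_{q,q}\}$. $\overline{X}=X\to X$, $\widetilde{X}=\overline{X}\to X$, $\underline{X}=X\to\widetilde{X}$, $\overline{X}^{\,0}=X$, $\overline{X}^{\,i+1}=\overline{\overline{X}^{\,i}}$, $\underline{X}_0=X$, $\underline{X}_{i+1}=\underline{\underline{X}_i}$. Types: $F=z_3\,\overline{y}^{\,3}\,\overline{y}^{\,2}\,\overline{y}$; $S=z_3\,\overline{y}^{\,2}\,\overline{y}^{\,1}\,y$; $Q=z_3\,\underline{y}\,y\,\underline{y}$; $G=z_3\,\underline{y}_2\,\overline{y}\,\overline{(\underline{y})}$; $M=z_3\,\widetilde{(\underline{y})}\,y\,\underline{y}$; $B=F\to S\to S$; $A=Q\to G\to M$; $E=\Pi\delta^{z_3}.B$; $D=\Pi\delta^{z_3}.A$; $E_1=\overline{y}^{\,4}$, $E_2=\overline{y}^{\,3}$, $E_3=\overline{y}^{\,2}$; $D_1=\underline{y}\to\underline{y}_2\to\widetilde{(\underline{y})}$, $D_2=\underline{y}$, $D_3=\underline{y}_2$; $C_1=\overline{y}^{\,2}$; $C_2=\widetilde{(\underline{y})}$; $C=z_2\,C_1\,C_2$; $O=z_2\,E\,D$; $R'=O\to C$; $R=\Pi\delta^{z_2}.R'$; $R_1=E\to C_1$; $R_2=D\to C_2$. Declarations (with $h,r,o,f,s,q,g$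 distinct variables of sort $\ast$): $\delta^h=h{:}(C_1\to C_2\to y)$, $\delta^r=r{:}R$, $\delta^o=o{:}O$, $\delta^f=f{:}F$, $\delta^s=s{:}S$, $\delta^q=q{:}Q$, $\delta^g=g{:}G$. Terms: $T=\lambda\delta^{z_3}.\lambda\delta^f.\lambda\delta^s.\,f\,s$; $J=\lambda\delta^{z_3}.\lambda\delta^q.\lambda\delta^g.\,g\,q$; $L=h\,(r\,P_{1,2}\,T)\,(r\,P_{2,2}\,J)$; $V=\lambda\delta^{z_2}.\lambda\delta^o.\,(o\,P_{1,3})\,(o\,P_{2,3})\,(o\,P_{3,3})$; $U=(\lambda\delta^r.L)\,V$. -}

module Defs where

open import Data.Nat using (ℕ; zero; suc; _+_; _*_; _⊔_; _∸_; _≡ᵇ_)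
open import Data.Bool using (Bool; true; false; if_then_else_)
open import Data.List using (List; []; _∷_; map; length; applyUpTo; reverse; _++_)
open import Data.List.Relation.Unary.Any using (Any)
open import Data.List.Relation.Unary.All using (All)
open import Data.List.Membership.Propositional using (_∈_)
open import Data.Product using (_×_; _,_; proj₁; proj₂)
open import Relation.Binary.PropositionalEquality using (_≡_; _≢_)
open import Relation.Binary.Construct.Closure.Equivalence using (EqClosure)

data Sort : Set where
  ∗ □ : Sort

data Binder : Set where
  lamB piB : Binder

-- bnd π ς ρ X Y  represents  π x^ς ρ : X . Y
-- (ρ and X are outside the scope of x; Y is inside)
-- A restriction ∈̄{X₁,…,Xₙ} is the list X₁ ∷ … ∷ Xₙ ∷ []; ◇ is [].
data Term : Set where
  srt : Sort → Term
  var : ℕ → Term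
  bnd : Binder → Sort → List Term → Term → Term → Term
  app : Term → Term → Term

Restr : Set
Restr = List Term

shiftVar : ℕ → ℕ → ℕ
shiftVar zero n = suc n
shiftVar (suc c) zero = zero
shiftVar (suc c) (suc n) = suc (shiftVar c n)

mutual
  shift : ℕ → Term → Term
  shift c (srt s) = srt s
  shift c (var n) = var (shiftVar c n)
  shift c (bnd b s ρ X Y) = bnd b s (shifts c ρ) (shift c X) (shift (suc c) Y)
  shift c (app X Y) = app (shift c X) (shift c Y)

  shifts : ℕ → List Term → List Term
  shifts c [] = []
  shifts c (X ∷ Xs) = shift c X ∷ shifts c Xs

-- substitution of N (living outside the binder) for index d
subVar : ℕ → ℕ → Term → Term
subVar zero zero N = N
subVar zero (suc n) N = var n
subVar (suc d) zero N = var zero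
subVar (suc d) (suc n) N = shift 0 (subVar d n N)

mutual
  sub : ℕ → Term → Term → Term
  sub d N (srt s) = srt s
  sub d N (var n) = subVar d n N
  sub d N (bnd b s ρ X Y) = bnd b s (subs d N ρ) (sub d N X) (sub (suc d) N Y)
  sub d N (app X Y) = app (sub d N X) (sub d N Y)

  subs : ℕ → Term → List Term → List Term
  subs d N [] = []
  subs d N (X ∷ Xs) = sub d N X ∷ subs d N Xs

infix 4 _→β_ _→βs_ _=β_

data _→β_ : Term → Term → Set
data _→βs_ : List Term → List Term → Set

data _→β_ where
  beta : ∀ {s ρ X Y Z} → app (bnd lamB s ρ X Y) Z →β sub 0 Z Y
  bndρ : ∀ {b s ρ ρ' X Y} → ρ →βs ρ' → bnd b s ρ X Y →β bnd b s ρ' X Y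
  bndX : ∀ {b s ρ X X' Y} → X →β X' → bnd b s ρ X Y →β bnd b s ρ X' Y
  bndY : ∀ {b s ρ X Y Y'} → Y →β Y' → bnd b s ρ X Y →β bnd b s ρ X Y'
  appL : ∀ {X X' Y} → X →β X' → app X Y →β app X' Y
  appR : ∀ {X Y Y'} → Y →β Y' → app X Y →β app X Y'

data _→βs_ where
  here  : ∀ {X X' Xs} → X →β X' → (X ∷ Xs) →βs (X' ∷ Xs)
  there : ∀ {X Xs Xs'} → Xs →βs Xs' → (X ∷ Xs) →βs (X ∷ Xs')

_=β_ : Term → Term → Set
_=β_ = EqClosure _→β_

record Decl : Set where
  constructor decl
  field
    sort  : Sort
    restr : Restr
    type  : Term

infixl 5 _▸_

data Ctx : Set where
  ε   : Ctx
  _▸_ : Ctx → Decl → Ctx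

-- An unrestricted declaration
-- (ρ = ◇ = []) is kept as a [] placeholder (needed for de Bruijn
-- indices) and is ignored by ⊩ (rule skip), exactly as if removed.
rdec : Ctx → List Restr
rdec ε = []
rdec (Δ ▸ decl _ ρ _) = rdec Δ ++ (ρ ∷ [])

-- Γ[x:=N] for the entries following x (entry j refers to x as index j)
subΓ : ℕ → Term → List Restr → List Restr
subΓ d N [] = []
subΓ d N (ρ ∷ Γ) = subs d N ρ ∷ subΓ (suc d) N Γ

infix 3 _⊩_∈̄_
data _⊩_∈̄_ : List Restr → Term → Restr → Set where
  ref  : ∀ {Y ρ} → Any (Y =β_) ρ → [] ⊩ Y ∈̄ ρ
  skip : ∀ {Γ Y ρ} → Γ ⊩ Y ∈̄ ρ → ([] ∷ Γ) ⊩ Y ∈̄ ρ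
  ctR  : ∀ {X₀ Xs Γ Y ρ} →
         (∀ {X} → X ∈ (X₀ ∷ Xs) →
            subΓ 0 X Γ ⊩ sub (length Γ) X Y ∈̄ subs (length Γ) X ρ) →
         ((X₀ ∷ Xs) ∷ Γ) ⊩ Y ∈̄ ρ

data Der (ℛ : Sort → Sort → Set) : Ctx → Term → Term → Set where
  axiom : Der ℛ ε (srt ∗) (srt □)
  weak  : ∀ {Δ δ X Y Z W} → Der ℛ (Δ ▸ δ) X Y → Der ℛ Δ Z W →
          Der ℛ (Δ ▸ δ) (shift 0 Z) (shift 0 W)
  start : ∀ {Δ ς ρ X} → Der ℛ Δ X (srt ς) → All (λ Y → Der ℛ Δ Y X) ρ →
          Der ℛ (Δ ▸ decl ς ρ X) (var 0) (shift 0 X)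
  pi    : ∀ {Δ ς₀ ρ X Y ς ς'} → Der ℛ (Δ ▸ decl ς₀ ρ X) Y (srt ς) →
          Der ℛ Δ X (srt ς') → ℛ ς' ς →
          Der ℛ Δ (bnd piB ς₀ ρ X Y) (srt ς)
  lam   : ∀ {Δ ς₀ ρ X Y Y' ς} → Der ℛ (Δ ▸ decl ς₀ ρ X) Y' Y →
          Der ℛ Δ (bnd piB ς₀ ρ X Y) (srt ς) →
          Der ℛ Δ (bnd lamB ς₀ ρ X Y') (bnd piB ς₀ ρ X Y)
  appl  : ∀ {Δ Z W ς₀ ρ X Y} → Der ℛ Δ Z (bnd piB ς₀ ρ X Y) → Der ℛ Δ W X →
          (ρ ≢ [] → rdec Δ ⊩ W ∈̄ ρ) →
          Der ℛ Δ (app Z W) (sub 0 W Y)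
  conv  : ∀ {Δ X Y Z ς} → Der ℛ Δ X Y → Der ℛ Δ Z (srt ς) →
          rdec Δ ⊩ Y ∈̄ (Z ∷ []) → Der ℛ Δ X Z

-- Named surface syntax (variables x^ς are pairs (ς , n)), translated
-- to de Bruijn terms.  Names not bound are free variables, mapped
-- injectively to indices beyond the bound ones.

Name : Set
Name = Sort × ℕ

code : Name → ℕ
code (∗ , n) = n * 2
code (□ , n) = suc (n * 2)

eqN : Name → Name → Bool
eqN (∗ , m) (∗ , n) = m ≡ᵇ n
eqN (□ , m) (□ , n) = m ≡ᵇ n
eqN _ _ = false

idx : List Name → Name → ℕ
idx [] x = code x
idx (y ∷ env) x = if eqN x y then zero else suc (idx env x)

data NTerm : Set where
  ‵srt : Sort → NTerm
  ‵var : Name → NTerm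
  ‵bnd : Binder → Name → List NTerm → NTerm → NTerm → NTerm
  ‵app : NTerm → NTerm → NTerm

mutual
  -- env: bound names, innermost first
  tr : List Name → NTerm → Term
  tr env (‵srt s) = srt s
  tr env (‵var x) = var (idx env x)
  tr env (‵bnd b x ρ X Y) = bnd b (proj₁ x) (trs env ρ) (tr env X) (tr (x ∷ env) Y)
  tr env (‵app X Y) = app (tr env X) (tr env Y)

  trs : List Name → List NTerm → List Term
  trs env [] = []
  trs env (X ∷ Xs) = tr env X ∷ trs env Xs

♯srt : Sort → ℕ
♯srt □ = 3
♯srt ∗ = 2

♯ : NTerm → ℕ
♯ (‵srt ς) = ♯srt ς
♯ (‵var (ς , _)) = ♯srt ς ∸ 2
♯ (‵bnd _ _ _ _ Y) = ♯ Y
♯ (‵app X _) = ♯ X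

mutual
  maxN : NTerm → ℕ
  maxN (‵srt _) = 0
  maxN (‵var (_ , n)) = n
  maxN (‵bnd _ (_ , n) ρ X Y) = n ⊔ maxNs ρ ⊔ maxN X ⊔ maxN Y
  maxN (‵app X Y) = maxN X ⊔ maxN Y

  maxNs : List NTerm → ℕ
  maxNs [] = 0
  maxNs (X ∷ Xs) = maxN X ⊔ maxNs Xs

-- sort of the dummy variable: ∗ if ♯X = 1, □ if ♯X = 2
-- (other degrees do not occur; ∗ is an arbitrary default there)
arrSort : ℕ → Sort
arrSort 2 = □
arrSort _ = ∗

infixr 6 _⇒_
infixl 8 _·_

-- X → Y = Π w:X.Y with w fresh (not occurring in Y)
_⇒_ : NTerm → NTerm → NTerm
X ⇒ Y = ‵bnd piB (arrSort (♯ X) , suc (maxN Y)) [] X Y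

_·_ : NTerm → NTerm → NTerm
_·_ = ‵app

NDecl : Set
NDecl = Name × List NTerm × NTerm

Λ[_]_ : NDecl → NTerm → NTerm
Λ[ (x , ρ , X) ] Y = ‵bnd lamB x ρ X Y

Π[_]_ : NDecl → NTerm → NTerm
Π[ (x , ρ , X) ] Y = ‵bnd piB x ρ X Y

-- named contexts: list of declarations, outermost first (paper order)
namesOf : List NDecl → List Name
namesOf ds = reverse (map proj₁ ds)

trCtxAux : Ctx → List Name → List NDecl → Ctx
trCtxAux Δ env [] = Δ
trCtxAux Δ env ((x , ρ , X) ∷ ds) =
  trCtxAux (Δ ▸ decl (proj₁ x) (trs env ρ) (tr env X)) (x ∷ env) ds

trCtx : List NDecl → Ctx
trCtx ds = trCtxAux ε [] ds

⊢ₙ : (Sort → Sort → Set) → List NDecl → NTerm → NTerm → Set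
⊢ₙ ℛ Δ X Y = Der ℛ (trCtx Δ) (tr (namesOf Δ) X) (tr (namesOf Δ) Y)

⊢ₙ₂ : (Sort → Sort → Set) → List NDecl → NTerm → NTerm → NTerm → Set
⊢ₙ₂ ℛ Δ X Y Z = ⊢ₙ ℛ Δ X Y × ⊢ₙ ℛ Δ Y Z

trR : List Name → List (Name × List NTerm) → List Restr
trR env [] = []
trR env ((x , ρ) ∷ γ) = trs env ρ ∷ trR (x ∷ env) γ

⊩ₙ : List (Name × List NTerm) → NTerm → List NTerm → Set
⊩ₙ γ Y ρ = trR [] γ ⊩ tr env Y ∈̄ trs env ρ
  where env = reverse (map proj₁ γ)

yv : Name
yv = (□ , 0)

zv : ℕ → Name
zv q = (□ , 10 + q)

xv : ℕ → Name
xv i = (□ , 100 + i)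

hv rv ov fv sv qv gv : Name
hv = (∗ , 1)
rv = (∗ , 2)
ov = (∗ , 3)
fv = (∗ , 4)
sv = (∗ , 5)
qv = (∗ , 6)
gv = (∗ , 7)

y : NTerm
y = ‵var yv

z₂ z₃ : NTerm
z₂ = ‵var (zv 2)
z₃ = ‵var (zv 3)

starₙ : ℕ → NTerm
starₙ zero = ‵srt ∗
starₙ (suc i) = ‵srt ∗ ⇒ starₙ i

δx : ℕ → NDecl
δx i = (xv i , [] , ‵srt ∗)

lamsFrom : ℕ → ℕ → NTerm → NTerm
lamsFrom j zero b = b
lamsFrom j (suc k) b = Λ[ δx j ] lamsFrom (suc j) k b

P : ℕ → ℕ → NTerm
P i q = lamsFrom 1 q (‵var (xv i))

Ps : ℕ → List NTerm
Ps q = applyUpTo (λ i → P (suc i) q) q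

δy : NDecl
δy = (yv , [] , ‵srt ∗)

δz : ℕ → NDecl
δz q = (zv q , Ps q , starₙ q)

γz : ℕ → Name × List NTerm
γz q = (zv q , Ps q)

ovl til ul : NTerm → NTerm
ovl X = X ⇒ X
til X = ovl X ⇒ X
ul X = X ⇒ til X

ovlⁿ : ℕ → NTerm → NTerm
ovlⁿ zero X = X
ovlⁿ (suc i) X = ovl (ovlⁿ i X)

ulₙ : ℕ → NTerm → NTerm
ulₙ zero X = X
ulₙ (suc i) X = ul (ulₙ i X)

F S Q G M B A E D : NTerm
F = z₃ · ovlⁿ 3 y · ovlⁿ 2 y · ovl y
S = z₃ · ovlⁿ 2 y · ovlⁿ 1 y · y
Q = z₃ · ul y · y · ul y
G = z₃ · ulₙ 2 y · ovl y · ovl (ul y)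
M = z₃ · til (ul y) · y · ul y
B = F ⇒ S ⇒ S
A = Q ⇒ G ⇒ M
E = Π[ δz 3 ] B
D = Π[ δz 3 ] A

E₁ E₂ E₃ D₁ D₂ D₃ C₁ C₂ C O R′ R R₁ R₂ : NTerm
E₁ = ovlⁿ 4 y
E₂ = ovlⁿ 3 y
E₃ = ovlⁿ 2 y
D₁ = ul y ⇒ ulₙ 2 y ⇒ til (ul y)
D₂ = ul y
D₃ = ulₙ 2 y
C₁ = ovlⁿ 2 y
C₂ = til (ul y)
C = z₂ · C₁ · C₂
O = z₂ · E · D
R′ = O ⇒ C
R = Π[ δz 2 ] R′
R₁ = E ⇒ C₁
R₂ = D ⇒ C₂

δh δr δo δf δs δq δg : NDecl
δh = (hv , [] , (C₁ ⇒ C₂ ⇒ y))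
δr = (rv , [] , R)
δo = (ov , [] , O)
δf = (fv , [] , F)
δs = (sv , [] , S)
δq = (qv , [] , Q)
δg = (gv , [] , G)

h r o f s q g : NTerm
h = ‵var hv
r = ‵var rv
o = ‵var ov
f = ‵var fv
s = ‵var sv
q = ‵var qv
g = ‵var gv

T J L V U : NTerm
T = Λ[ δz 3 ] Λ[ δf ] Λ[ δs ] (f · s)
J = Λ[ δz 3 ] Λ[ δq ] Λ[ δg ] (g · q)
L = h · (r · P 1 2 · T) · (r · P 2 2 · J)
V = Λ[ δz 2 ] Λ[ δo ] (o · P 1 3 · (o · P 2 3) · (o · P 3 3))
U = (Λ[ δr ] L) · V

{-# OPTIONS --safe #-}
-- Every side condition Γ ⊩ Y ρ arising here is a finite check: the only
-- restricted variables are z₂ and z₃, whose admissible values are the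
-- projections P_{i,q}, so one instantiates them in every admissible way and
-- compares β-normal forms.  This is what lets f s be typed although F and
-- S → S are not β-equal: under z₃ := P_{1,3}, P_{2,3}, P_{3,3} both become
-- ȳ² → ȳ², ȳ → ȳ and y → y respectively.  Likewise, by (1c), o can be
-- applied to each P_{i,3}, and under z₂ := P_{1,2}, P_{2,2} the type
-- z₂ E₁ D₁ becomes z₂ E₂ D₂ → z₂ E₃ D₃ → C, so the three applications
-- compose.  Each check is done by a search returning the ⊩-derivation
-- itself, so no soundness argument is needed.
module Submission where

open import Defs
import Data.Bool as Bool
open import Data.Empty using (⊥-elim)
open import Data.Fin using (Fin; toℕ; #_)
open import Data.List using (List; []; _∷_; length)
open import Data.List.Relation.Unary.All as All using ([]; _∷_)
open import Data.List.Relation.Unary.Any using (Any; here; there)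
open import Data.Maybe using (Maybe; just; nothing; _<∣>_; _>>=_; is-just; to-witness-T)
import Data.Maybe as Maybe
open import Data.Maybe.Effectful using (applicative)
open import Data.Nat using (ℕ; zero; suc)
import Data.Nat as ℕ
open import Data.Product using (_×_; _,_; ∃)
open import Data.Unit using (tt)
open import Level using (0ℓ)
open import Relation.Binary.PropositionalEquality using (_≡_; refl)
open import Relation.Binary.Construct.Closure.ReflexiveTransitive as Star using (Star; _◅_; _◅◅_)
open import Relation.Binary.Construct.Closure.Symmetric using (fwd)
open import Relation.Binary.Construct.Closure.Equivalence using (symmetric)
open import Relation.Nullary.Decidable using (dec⇒maybe)

_≡ˢ?_ : (a b : Sort) → Maybe (a ≡ b)
∗ ≡ˢ? ∗ = just refl
□ ≡ˢ? □ = just refl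
_ ≡ˢ? _ = nothing

_≡ᴮ?_ : (a b : Binder) → Maybe (a ≡ b)
lamB ≡ᴮ? lamB = just refl
piB ≡ᴮ? piB = just refl
_ ≡ᴮ? _ = nothing

mutual
  _≡ᵗ?_ : (X Y : Term) → Maybe (X ≡ Y)
  srt a ≡ᵗ? srt b = do
    refl ← a ≡ˢ? b
    just refl
  var m ≡ᵗ? var n = do
    refl ← dec⇒maybe (m ℕ.≟ n)
    just refl
  bnd b s ρ X Y ≡ᵗ? bnd b′ s′ ρ′ X′ Y′ = do
    refl ← b ≡ᴮ? b′
    refl ← s ≡ˢ? s′
    refl ← ρ ≡ᵗˢ? ρ′
    refl ← X ≡ᵗ? X′
    refl ← Y ≡ᵗ? Y′
    just refl
  app X Y ≡ᵗ? app X′ Y′ = do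
    refl ← X ≡ᵗ? X′
    refl ← Y ≡ᵗ? Y′
    just refl
  _ ≡ᵗ? _ = nothing

  _≡ᵗˢ?_ : (Xs Ys : List Term) → Maybe (Xs ≡ Ys)
  [] ≡ᵗˢ? [] = just refl
  (X ∷ Xs) ≡ᵗˢ? (Y ∷ Ys) = do
    refl ← X ≡ᵗ? Y
    refl ← Xs ≡ᵗˢ? Ys
    just refl
  _ ≡ᵗˢ? _ = nothing

mutual
  step? : (X : Term) → Maybe (∃ (X →β_))
  step? (bnd b s ρ X Y) =
    Maybe.map (λ (_ , p) → _ , bndρ p) (steps? ρ) <∣>
    Maybe.map (λ (_ , p) → _ , bndX p) (step? X) <∣>
    Maybe.map (λ (_ , p) → _ , bndY p) (step? Y)
  step? (app (bnd lamB s ρ X Y) Z) = just (_ , beta)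
  step? (app X Z) =
    Maybe.map (λ (_ , p) → _ , appL p) (step? X) <∣>
    Maybe.map (λ (_ , p) → _ , appR p) (step? Z)
  step? _ = nothing

  steps? : (Xs : List Term) → Maybe (∃ (Xs →βs_))
  steps? [] = nothing
  steps? (X ∷ Xs) =
    Maybe.map (λ (_ , p) → _ , here p) (step? X) <∣>
    Maybe.map (λ (_ , p) → _ , there p) (steps? Xs)

reduce : ℕ → (X : Term) → ∃ (Star _→β_ X)
reduce zero X = X , Star.ε
reduce (suc n) X with step? X
... | nothing = X , Star.ε
... | just (X′ , p) with reduce n X′
... | (Y , ps) = Y , p ◅ ps

=β? : (X Y : Term) → Maybe (X =β Y)
=β? X Y with reduce 100 X | reduce 100 Y
... | (X′ , X↠X′) | (Y′ , Y↠Y′) = do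
  refl ← X′ ≡ᵗ? Y′
  just (Star.map fwd X↠X′ ◅◅ symmetric _→β_ (Star.map fwd Y↠Y′))

any? : {A : Set} {P : A → Set} → (∀ x → Maybe (P x)) → ∀ xs → Maybe (Any P xs)
any? f [] = nothing
any? f (x ∷ xs) = Maybe.map here (f x) <∣> Maybe.map there (any? f xs)

-- Fuel because subΓ 0 X Γ is not structurally smaller than Γ; length Γ suffices.
⊩? : ℕ → (Γ : List Restr) (Y : Term) (ρ : Restr) → Maybe (Γ ⊩ Y ∈̄ ρ)
⊩? _ [] Y ρ = Maybe.map ref (any? (=β? Y) ρ)
⊩? zero (_ ∷ _) Y ρ = nothing
⊩? (suc n) ([] ∷ Γ) Y ρ = Maybe.map skip (⊩? n Γ Y ρ)
⊩? (suc n) (ρ₀@(_ ∷ _) ∷ Γ) Y ρ =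
  Maybe.map (λ ⊩instances → ctR (All.lookup ⊩instances))
    (All.sequenceA 0ℓ applicative (All.universal ⊩instance? ρ₀))
  where
  ⊩instance? : ∀ X → Maybe (subΓ 0 X Γ ⊩ sub (length Γ) X Y ∈̄ subs (length Γ) X ρ)
  ⊩instance? X = ⊩? n (subΓ 0 X Γ) (sub (length Γ) X Y) (subs (length Γ) X ρ)

⊩-by-search : ∀ {Γ Y ρ} → Bool.T (is-just (⊩? (length Γ) Γ Y ρ)) → Γ ⊩ Y ∈̄ ρ
⊩-by-search = to-witness-T _

infixl 5 _▸∗ⁿ_
_▸∗ⁿ_ : Ctx → ℕ → Ctx
Δ ▸∗ⁿ zero = Δ
Δ ▸∗ⁿ suc k = Δ ▸∗ⁿ k ▸ decl □ [] (srt ∗)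

Π∗ⁿ λ∗ⁿ : ℕ → Term → Term
Π∗ⁿ zero K = K
Π∗ⁿ (suc k) K = Π∗ⁿ k (bnd piB □ [] (srt ∗) K)
λ∗ⁿ zero b = b
λ∗ⁿ (suc k) b = λ∗ⁿ k (bnd lamB □ [] (srt ∗) b)

∗ₖ : ℕ → Term
∗ₖ k = Π∗ⁿ k (srt ∗)

infixr 6 _⟶_
_⟶_ : Term → Term → Term
X ⟶ Y = bnd piB ∗ [] X (shift 0 Y)

-- De Bruijn images of the named types of Defs, with the terms standing
-- for z₃ and y as parameters so that they can be formed in any context.
ovlᵗ tilᵗ ulᵗ : Term → Term
ovlᵗ X = X ⟶ X
tilᵗ X = ovlᵗ X ⟶ X
ulᵗ X = X ⟶ tilᵗ X

ovlᵗⁿ ulᵗₙ : ℕ → Term → Term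
ovlᵗⁿ zero X = X
ovlᵗⁿ (suc i) X = ovlᵗ (ovlᵗⁿ i X)
ulᵗₙ zero X = X
ulᵗₙ (suc i) X = ulᵗ (ulᵗₙ i X)

app₂ : Term → Term → Term → Term
app₂ z a b = app (app z a) b

app₃ : Term → Term → Term → Term → Term
app₃ z a b c = app (app₂ z a b) c

Fᵗ Sᵗ Qᵗ Gᵗ Mᵗ Bᵗ Aᵗ : Term → Term → Term
Fᵗ z Y = app₃ z (ovlᵗⁿ 3 Y) (ovlᵗⁿ 2 Y) (ovlᵗ Y)
Sᵗ z Y = app₃ z (ovlᵗⁿ 2 Y) (ovlᵗⁿ 1 Y) Y
Qᵗ z Y = app₃ z (ulᵗ Y) Y (ulᵗ Y)
Gᵗ z Y = app₃ z (ulᵗₙ 2 Y) (ovlᵗ Y) (ovlᵗ (ulᵗ Y))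
Mᵗ z Y = app₃ z (tilᵗ (ulᵗ Y)) Y (ulᵗ Y)
Bᵗ z Y = Fᵗ z Y ⟶ Sᵗ z Y ⟶ Sᵗ z Y
Aᵗ z Y = Qᵗ z Y ⟶ Gᵗ z Y ⟶ Mᵗ z Y

module DerivedRules (ℛ : Sort → Sort → Set) where

  infix 3 _⊢_∶_
  _⊢_∶_ : Ctx → Term → Term → Set
  _⊢_∶_ = Der ℛ

  private variable
    Δ : Ctx
    a b c z K X Y W Z : Term
    ς : Sort
    k : ℕ

  app◇ : Δ ⊢ Z ∶ bnd piB ς [] X Y → Δ ⊢ W ∶ X → Δ ⊢ app Z W ∶ sub 0 W Y
  app◇ ⊢Z ⊢W = appl ⊢Z ⊢W (λ []≢[] → ⊥-elim ([]≢[] refl))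

  appᴿ : ∀ {ρ} → Δ ⊢ Z ∶ bnd piB ς ρ X Y → Δ ⊢ W ∶ X → rdec Δ ⊩ W ∈̄ ρ →
         Δ ⊢ app Z W ∶ sub 0 W Y
  appᴿ ⊢Z ⊢W ⊩W = appl ⊢Z ⊢W (λ _ → ⊩W)

  weaken◇ : Δ ⊢ X ∶ srt ς → Δ ⊢ Z ∶ W → Δ ▸ decl ς [] X ⊢ shift 0 Z ∶ shift 0 W
  weaken◇ ⊢X = weak (start ⊢X [])

  ▸∗ⁿ-sort : Δ ⊢ srt ∗ ∶ srt □ → Δ ▸∗ⁿ k ⊢ srt ∗ ∶ srt □
  ▸∗ⁿ-sort {k = zero} ⊢∗ = ⊢∗
  ▸∗ⁿ-sort {k = suc k} ⊢∗ = weaken◇ (▸∗ⁿ-sort ⊢∗) (▸∗ⁿ-sort ⊢∗)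

  ▸∗ⁿ-var : Δ ⊢ srt ∗ ∶ srt □ → (j : Fin k) → Δ ▸∗ⁿ k ⊢ var (toℕ j) ∶ srt ∗
  ▸∗ⁿ-var {k = suc k} ⊢∗ Fin.zero = start (▸∗ⁿ-sort ⊢∗) []
  ▸∗ⁿ-var {k = suc k} ⊢∗ (Fin.suc j) = weaken◇ (▸∗ⁿ-sort ⊢∗) (▸∗ⁿ-var ⊢∗ j)

  app₂-formation : Δ ⊢ z ∶ ∗ₖ 2 → Δ ⊢ a ∶ srt ∗ → Δ ⊢ b ∶ srt ∗ → Δ ⊢ app₂ z a b ∶ srt ∗
  app₂-formation ⊢z ⊢a ⊢b = app◇ (app◇ ⊢z ⊢a) ⊢b

  app₃-formation : Δ ⊢ z ∶ ∗ₖ 3 → Δ ⊢ a ∶ srt ∗ → Δ ⊢ b ∶ srt ∗ → Δ ⊢ c ∶ srt ∗ →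
                   Δ ⊢ app₃ z a b c ∶ srt ∗
  app₃-formation ⊢z ⊢a ⊢b ⊢c = app◇ (app◇ (app◇ ⊢z ⊢a) ⊢b) ⊢c

  module Kinds (□□ : ℛ □ □) where

    Π∗ⁿ-formation : Δ ⊢ srt ∗ ∶ srt □ → Δ ▸∗ⁿ k ⊢ K ∶ srt □ → Δ ⊢ Π∗ⁿ k K ∶ srt □
    Π∗ⁿ-formation {k = zero} ⊢∗ ⊢K = ⊢K
    Π∗ⁿ-formation {k = suc k} ⊢∗ ⊢K = Π∗ⁿ-formation ⊢∗ (pi ⊢K (▸∗ⁿ-sort ⊢∗) □□)

    λ∗ⁿ-typing : Δ ⊢ srt ∗ ∶ srt □ → Δ ▸∗ⁿ k ⊢ K ∶ srt □ → Δ ▸∗ⁿ k ⊢ b ∶ K →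
                 Δ ⊢ λ∗ⁿ k b ∶ Π∗ⁿ k K
    λ∗ⁿ-typing {k = zero} ⊢∗ ⊢K ⊢b = ⊢b
    λ∗ⁿ-typing {k = suc k} ⊢∗ ⊢K ⊢b = λ∗ⁿ-typing ⊢∗ ⊢Π∗K (lam ⊢b ⊢Π∗K)
      where ⊢Π∗K = pi ⊢K (▸∗ⁿ-sort ⊢∗) □□

    ∗ₖ-formation : ∀ k → Δ ⊢ srt ∗ ∶ srt □ → Δ ⊢ ∗ₖ k ∶ srt □
    ∗ₖ-formation k ⊢∗ = Π∗ⁿ-formation ⊢∗ (▸∗ⁿ-sort {k = k} ⊢∗)

    -- The paper's P_{i,q} translates to  λ∗ⁿ q (var (q ∸ i)).
    projection-typing : ∀ k (j : Fin k) → Δ ⊢ srt ∗ ∶ srt □ → Δ ⊢ λ∗ⁿ k (var (toℕ j)) ∶ ∗ₖ k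
    projection-typing k j ⊢∗ = λ∗ⁿ-typing ⊢∗ (▸∗ⁿ-sort ⊢∗) (▸∗ⁿ-var ⊢∗ j)

    z₃-typing : Δ ⊢ srt ∗ ∶ srt □ → Δ ▸ decl □ (trs [] (Ps 3)) (∗ₖ 3) ⊢ var 0 ∶ ∗ₖ 3
    z₃-typing ⊢∗ = start (∗ₖ-formation 3 ⊢∗)
      (projection-typing 3 (# 2) ⊢∗ ∷ projection-typing 3 (# 1) ⊢∗ ∷ projection-typing 3 (# 0) ⊢∗ ∷ [])

    z₂-typing : Δ ⊢ srt ∗ ∶ srt □ → Δ ▸ decl □ (trs [] (Ps 2)) (∗ₖ 2) ⊢ var 0 ∶ ∗ₖ 2
    z₂-typing ⊢∗ = start (∗ₖ-formation 2 ⊢∗)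
      (projection-typing 2 (# 1) ⊢∗ ∷ projection-typing 2 (# 0) ⊢∗ ∷ [])

  module Arrows (∗∗ : ℛ ∗ ∗) where

    ⟶-formation : Δ ⊢ X ∶ srt ∗ → Δ ⊢ Y ∶ srt ∗ → Δ ⊢ X ⟶ Y ∶ srt ∗
    ⟶-formation ⊢X ⊢Y = pi (weaken◇ ⊢X ⊢Y) ⊢X ∗∗

    ovlᵗ-formation : Δ ⊢ X ∶ srt ∗ → Δ ⊢ ovlᵗ X ∶ srt ∗
    ovlᵗ-formation ⊢X = ⟶-formation ⊢X ⊢X

    tilᵗ-formation : Δ ⊢ X ∶ srt ∗ → Δ ⊢ tilᵗ X ∶ srt ∗
    tilᵗ-formation ⊢X = ⟶-formation (ovlᵗ-formation ⊢X) ⊢X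

    ulᵗ-formation : Δ ⊢ X ∶ srt ∗ → Δ ⊢ ulᵗ X ∶ srt ∗
    ulᵗ-formation ⊢X = ⟶-formation ⊢X (tilᵗ-formation ⊢X)

    ovlᵗⁿ-formation : ∀ i → Δ ⊢ X ∶ srt ∗ → Δ ⊢ ovlᵗⁿ i X ∶ srt ∗
    ovlᵗⁿ-formation zero ⊢X = ⊢X
    ovlᵗⁿ-formation (suc i) ⊢X = ovlᵗ-formation (ovlᵗⁿ-formation i ⊢X)

    ulᵗₙ-formation : ∀ i → Δ ⊢ X ∶ srt ∗ → Δ ⊢ ulᵗₙ i X ∶ srt ∗
    ulᵗₙ-formation zero ⊢X = ⊢X
    ulᵗₙ-formation (suc i) ⊢X = ulᵗ-formation (ulᵗₙ-formation i ⊢X)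

    module _ (⊢z : Δ ⊢ z ∶ ∗ₖ 3) (⊢Y : Δ ⊢ Y ∶ srt ∗) where

      Fᵗ-formation : Δ ⊢ Fᵗ z Y ∶ srt ∗
      Fᵗ-formation = app₃-formation ⊢z (ovlᵗⁿ-formation 3 ⊢Y) (ovlᵗⁿ-formation 2 ⊢Y) (ovlᵗ-formation ⊢Y)

      Sᵗ-formation : Δ ⊢ Sᵗ z Y ∶ srt ∗
      Sᵗ-formation = app₃-formation ⊢z (ovlᵗⁿ-formation 2 ⊢Y) (ovlᵗⁿ-formation 1 ⊢Y) ⊢Y

      Qᵗ-formation : Δ ⊢ Qᵗ z Y ∶ srt ∗
      Qᵗ-formation = app₃-formation ⊢z (ulᵗ-formation ⊢Y) ⊢Y (ulᵗ-formation ⊢Y)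

      Gᵗ-formation : Δ ⊢ Gᵗ z Y ∶ srt ∗
      Gᵗ-formation = app₃-formation ⊢z (ulᵗₙ-formation 2 ⊢Y) (ovlᵗ-formation ⊢Y) (ovlᵗ-formation (ulᵗ-formation ⊢Y))

      Mᵗ-formation : Δ ⊢ Mᵗ z Y ∶ srt ∗
      Mᵗ-formation = app₃-formation ⊢z (tilᵗ-formation (ulᵗ-formation ⊢Y)) ⊢Y (ulᵗ-formation ⊢Y)

      Bᵗ-formation : Δ ⊢ Bᵗ z Y ∶ srt ∗
      Bᵗ-formation = ⟶-formation Fᵗ-formation (⟶-formation Sᵗ-formation Sᵗ-formation)

      Aᵗ-formation : Δ ⊢ Aᵗ z Y ∶ srt ∗
      Aᵗ-formation = ⟶-formation Qᵗ-formation (⟶-formation Gᵗ-formation Mᵗ-formation)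

module Derivations (ℛ : Sort → Sort → Set) (∗∗ : ℛ ∗ ∗) (□□ : ℛ □ □) (□∗ : ℛ □ ∗) where
  open DerivedRules ℛ
  open Kinds □□
  open Arrows ∗∗

  infix 3 _⊢ₙ_∶_
  _⊢ₙ_∶_ : List NDecl → NTerm → NTerm → Set
  Δ ⊢ₙ X ∶ Y = ⊢ₙ ℛ Δ X Y

  Δy Δz₃ Δz₂ Δo Δh Δr : List NDecl
  Δy = δy ∷ []
  Δz₃ = δy ∷ δz 3 ∷ []
  Δz₂ = δy ∷ δz 2 ∷ []
  Δo = δy ∷ δz 2 ∷ δo ∷ []
  Δh = δy ∷ δh ∷ []
  Δr = δy ∷ δh ∷ δr ∷ []

  ⊢y : Δy ⊢ₙ y ∶ ‵srt ∗
  ⊢y = start axiom []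

  ⊢∗ : Δy ⊢ₙ ‵srt ∗ ∶ ‵srt □
  ⊢∗ = weak ⊢y axiom

  ⊢z₃ : Δz₃ ⊢ₙ z₃ ∶ starₙ 3
  ⊢z₃ = z₃-typing ⊢∗

  ⊢y³ : Δz₃ ⊢ₙ y ∶ ‵srt ∗
  ⊢y³ = weak ⊢z₃ ⊢y

  ⊢E : Δy ⊢ₙ E ∶ ‵srt ∗
  ⊢E = pi (Bᵗ-formation ⊢z₃ ⊢y³) (∗ₖ-formation 3 ⊢∗) □∗

  ⊢D : Δy ⊢ₙ D ∶ ‵srt ∗
  ⊢D = pi (Aᵗ-formation ⊢z₃ ⊢y³) (∗ₖ-formation 3 ⊢∗) □∗

  ⊢T : Δy ⊢ₙ T ∶ E
  ⊢T = lam (lam (lam ⊢f·s (⟶-formation ⊢Sᶠ ⊢Sᶠ)) (Bᵗ-formation ⊢z₃ ⊢y³)) ⊢E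
    where
    ⊢f : δy ∷ δz 3 ∷ δf ∷ [] ⊢ₙ f ∶ F
    ⊢f = start (Fᵗ-formation ⊢z₃ ⊢y³) []
    ⊢Sᶠ : δy ∷ δz 3 ∷ δf ∷ [] ⊢ₙ S ∶ ‵srt ∗
    ⊢Sᶠ = weak ⊢f (Sᵗ-formation ⊢z₃ ⊢y³)
    ⊢s : δy ∷ δz 3 ∷ δf ∷ δs ∷ [] ⊢ₙ s ∶ S
    ⊢s = start ⊢Sᶠ []
    ⊢Sˢ : δy ∷ δz 3 ∷ δf ∷ δs ∷ [] ⊢ₙ S ∶ ‵srt ∗
    ⊢Sˢ = weak ⊢s ⊢Sᶠ
    ⊢f·s : δy ∷ δz 3 ∷ δf ∷ δs ∷ [] ⊢ₙ f · s ∶ S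
    ⊢f·s = app◇ (conv (weak ⊢s ⊢f) (⟶-formation ⊢Sˢ ⊢Sˢ) (⊩-by-search tt)) ⊢s

  ⊢J : Δy ⊢ₙ J ∶ D
  ⊢J = lam (lam (lam ⊢g·q (⟶-formation ⊢Gᵠ ⊢Mᵠ)) (Aᵗ-formation ⊢z₃ ⊢y³)) ⊢D
    where
    ⊢Q : Δz₃ ⊢ₙ Q ∶ ‵srt ∗
    ⊢Q = Qᵗ-formation ⊢z₃ ⊢y³
    ⊢q : δy ∷ δz 3 ∷ δq ∷ [] ⊢ₙ q ∶ Q
    ⊢q = start ⊢Q []
    ⊢Gᵠ : δy ∷ δz 3 ∷ δq ∷ [] ⊢ₙ G ∶ ‵srt ∗
    ⊢Gᵠ = weak ⊢q (Gᵗ-formation ⊢z₃ ⊢y³)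
    ⊢Mᵠ : δy ∷ δz 3 ∷ δq ∷ [] ⊢ₙ M ∶ ‵srt ∗
    ⊢Mᵠ = weak ⊢q (Mᵗ-formation ⊢z₃ ⊢y³)
    ⊢g : δy ∷ δz 3 ∷ δq ∷ δg ∷ [] ⊢ₙ g ∶ G
    ⊢g = start ⊢Gᵠ []
    ⊢Q⇒M : δy ∷ δz 3 ∷ δq ∷ δg ∷ [] ⊢ₙ Q ⇒ M ∶ ‵srt ∗
    ⊢Q⇒M = ⟶-formation (weak ⊢g (weak ⊢q ⊢Q)) (weak ⊢g ⊢Mᵠ)
    ⊢g·q : δy ∷ δz 3 ∷ δq ∷ δg ∷ [] ⊢ₙ g · q ∶ M
    ⊢g·q = app◇ (conv ⊢g ⊢Q⇒M (⊩-by-search tt)) (weak ⊢g ⊢q)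

  ⊢z₂ : Δz₂ ⊢ₙ z₂ ∶ starₙ 2
  ⊢z₂ = z₂-typing ⊢∗

  ⊢O : Δz₂ ⊢ₙ O ∶ ‵srt ∗
  ⊢O = app₂-formation ⊢z₂ (weak ⊢z₂ ⊢E) (weak ⊢z₂ ⊢D)

  ⊢C : Δz₂ ⊢ₙ C ∶ ‵srt ∗
  ⊢C = app₂-formation ⊢z₂ (ovlᵗⁿ-formation 2 ⊢y²) (tilᵗ-formation (ulᵗ-formation ⊢y²))
    where ⊢y² = weak ⊢z₂ ⊢y

  ⊢R′ : Δz₂ ⊢ₙ R′ ∶ ‵srt ∗
  ⊢R′ = ⟶-formation ⊢O ⊢C

  ⊢R : Δy ⊢ₙ R ∶ ‵srt ∗
  ⊢R = pi ⊢R′ (∗ₖ-formation 2 ⊢∗) □∗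

  ⊢o : Δo ⊢ₙ o ∶ O
  ⊢o = start ⊢O []

  ⊢yᵒ : Δo ⊢ₙ y ∶ ‵srt ∗
  ⊢yᵒ = weak ⊢o (weak ⊢z₂ ⊢y)

  ⊢∗ᵒ : Δo ⊢ₙ ‵srt ∗ ∶ ‵srt □
  ⊢∗ᵒ = weak ⊢o (weak ⊢z₂ ⊢∗)

  ⊢z₂ᵒ : Δo ⊢ₙ z₂ ∶ starₙ 2
  ⊢z₂ᵒ = weak ⊢o ⊢z₂

  ⊢o∶ΠBA : Δo ⊢ₙ o ∶ Π[ δz 3 ] (z₂ · B · A)
  ⊢o∶ΠBA = conv ⊢o (pi ⊢z₂·B·A (∗ₖ-formation 3 ⊢∗ᵒ) □∗) (⊩-by-search tt)
    where
    ⊢z₃ᵒ : δy ∷ δz 2 ∷ δo ∷ δz 3 ∷ [] ⊢ₙ z₃ ∶ starₙ 3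
    ⊢z₃ᵒ = z₃-typing ⊢∗ᵒ
    ⊢yᶻ : δy ∷ δz 2 ∷ δo ∷ δz 3 ∷ [] ⊢ₙ y ∶ ‵srt ∗
    ⊢yᶻ = weak ⊢z₃ᵒ ⊢yᵒ
    ⊢z₂·B·A : δy ∷ δz 2 ∷ δo ∷ δz 3 ∷ [] ⊢ₙ z₂ · B · A ∶ ‵srt ∗
    ⊢z₂·B·A = app₂-formation (weak ⊢z₃ᵒ ⊢z₂ᵒ) (Bᵗ-formation ⊢z₃ᵒ ⊢yᶻ) (Aᵗ-formation ⊢z₃ᵒ ⊢yᶻ)

  ⊢z₂·E₁·D₁ : Δo ⊢ₙ z₂ · E₁ · D₁ ∶ ‵srt ∗
  ⊢z₂·E₁·D₁ = app₂-formation ⊢z₂ᵒ (ovlᵗⁿ-formation 4 ⊢yᵒ)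
    (⟶-formation (ulᵗ-formation ⊢yᵒ) (⟶-formation (ulᵗₙ-formation 2 ⊢yᵒ) (tilᵗ-formation (ulᵗ-formation ⊢yᵒ))))

  ⊢z₂·E₂·D₂ : Δo ⊢ₙ z₂ · E₂ · D₂ ∶ ‵srt ∗
  ⊢z₂·E₂·D₂ = app₂-formation ⊢z₂ᵒ (ovlᵗⁿ-formation 3 ⊢yᵒ) (ulᵗ-formation ⊢yᵒ)

  ⊢z₂·E₃·D₃ : Δo ⊢ₙ z₂ · E₃ · D₃ ∶ ‵srt ∗
  ⊢z₂·E₃·D₃ = app₂-formation ⊢z₂ᵒ (ovlᵗⁿ-formation 2 ⊢yᵒ) (ulᵗₙ-formation 2 ⊢yᵒ)

  ⊢o·P₁₃ : Δo ⊢ₙ o · P 1 3 ∶ z₂ · E₁ · D₁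
  ⊢o·P₁₃ = conv (appᴿ ⊢o∶ΠBA (projection-typing 3 (# 2) ⊢∗ᵒ) (⊩-by-search tt)) ⊢z₂·E₁·D₁ (⊩-by-search tt)

  ⊢o·P₂₃ : Δo ⊢ₙ o · P 2 3 ∶ z₂ · E₂ · D₂
  ⊢o·P₂₃ = conv (appᴿ ⊢o∶ΠBA (projection-typing 3 (# 1) ⊢∗ᵒ) (⊩-by-search tt)) ⊢z₂·E₂·D₂ (⊩-by-search tt)

  ⊢o·P₃₃ : Δo ⊢ₙ o · P 3 3 ∶ z₂ · E₃ · D₃
  ⊢o·P₃₃ = conv (appᴿ ⊢o∶ΠBA (projection-typing 3 (# 0) ⊢∗ᵒ) (⊩-by-search tt)) ⊢z₂·E₃·D₃ (⊩-by-search tt)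

  ⊢Cᵒ : Δo ⊢ₙ C ∶ ‵srt ∗
  ⊢Cᵒ = weak ⊢o ⊢C

  ⊢V-body : Δo ⊢ₙ o · P 1 3 · (o · P 2 3) · (o · P 3 3) ∶ C
  ⊢V-body = app◇ (app◇ (conv ⊢o·P₁₃ ⊢E₂D₂⇒E₃D₃⇒C (⊩-by-search tt)) ⊢o·P₂₃) ⊢o·P₃₃
    where
    ⊢E₂D₂⇒E₃D₃⇒C : Δo ⊢ₙ z₂ · E₂ · D₂ ⇒ z₂ · E₃ · D₃ ⇒ C ∶ ‵srt ∗
    ⊢E₂D₂⇒E₃D₃⇒C = ⟶-formation ⊢z₂·E₂·D₂ (⟶-formation ⊢z₂·E₃·D₃ ⊢Cᵒ)

  ⊢V : Δy ⊢ₙ V ∶ R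
  ⊢V = lam (lam ⊢V-body ⊢R′) ⊢R

  ⊢h : Δh ⊢ₙ h ∶ (C₁ ⇒ C₂ ⇒ y)
  ⊢h = start (⟶-formation (ovlᵗⁿ-formation 2 ⊢y) (⟶-formation (tilᵗ-formation (ulᵗ-formation ⊢y)) ⊢y)) []

  ⊢yʰ : Δh ⊢ₙ y ∶ ‵srt ∗
  ⊢yʰ = weak ⊢h ⊢y

  ⊢Rʰ : Δh ⊢ₙ R ∶ ‵srt ∗
  ⊢Rʰ = weak ⊢h ⊢R

  ⊢r : Δr ⊢ₙ r ∶ R
  ⊢r = start ⊢Rʰ []

  ⊢yʳ : Δr ⊢ₙ y ∶ ‵srt ∗
  ⊢yʳ = weak ⊢r ⊢yʰ

  ⊢∗ʳ : Δr ⊢ₙ ‵srt ∗ ∶ ‵srt □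
  ⊢∗ʳ = weak ⊢r (weak ⊢h ⊢∗)

  ⊢C₁ : Δr ⊢ₙ C₁ ∶ ‵srt ∗
  ⊢C₁ = ovlᵗⁿ-formation 2 ⊢yʳ

  ⊢C₂ : Δr ⊢ₙ C₂ ∶ ‵srt ∗
  ⊢C₂ = tilᵗ-formation (ulᵗ-formation ⊢yʳ)

  ⊢R₁ : Δr ⊢ₙ R₁ ∶ ‵srt ∗
  ⊢R₁ = ⟶-formation (weak ⊢r (weak ⊢h ⊢E)) ⊢C₁

  ⊢R₂ : Δr ⊢ₙ R₂ ∶ ‵srt ∗
  ⊢R₂ = ⟶-formation (weak ⊢r (weak ⊢h ⊢D)) ⊢C₂

  ⊢r·P₁₂ : Δr ⊢ₙ r · P 1 2 ∶ R₁
  ⊢r·P₁₂ = conv (appᴿ ⊢r (projection-typing 2 (# 1) ⊢∗ʳ) (⊩-by-search tt)) ⊢R₁ (⊩-by-search tt)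

  ⊢r·P₂₂ : Δr ⊢ₙ r · P 2 2 ∶ R₂
  ⊢r·P₂₂ = conv (appᴿ ⊢r (projection-typing 2 (# 0) ⊢∗ʳ) (⊩-by-search tt)) ⊢R₂ (⊩-by-search tt)

  ⊢r·P₁₂·T : Δr ⊢ₙ r · P 1 2 · T ∶ C₁
  ⊢r·P₁₂·T = app◇ ⊢r·P₁₂ (weak ⊢r (weak ⊢h ⊢T))

  ⊢r·P₂₂·J : Δr ⊢ₙ r · P 2 2 · J ∶ C₂
  ⊢r·P₂₂·J = app◇ ⊢r·P₂₂ (weak ⊢r (weak ⊢h ⊢J))

  ⊢L : Δr ⊢ₙ L ∶ y
  ⊢L = app◇ (app◇ (weak ⊢r ⊢h) ⊢r·P₁₂·T) ⊢r·P₂₂·J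

  ⊢Πr·y : Δh ⊢ₙ Π[ δr ] y ∶ ‵srt ∗
  ⊢Πr·y = pi ⊢yʳ ⊢Rʰ ∗∗

  ⊢λr·L : Δh ⊢ₙ Λ[ δr ] L ∶ Π[ δr ] y
  ⊢λr·L = lam ⊢L ⊢Πr·y

  ⊢U : Δh ⊢ₙ U ∶ y
  ⊢U = app◇ ⊢λr·L (weak ⊢h ⊢V)

lemma3 : (ℛ : Sort → Sort → Set) → ℛ ∗ ∗ → ℛ □ □ → ℛ □ ∗ →
  -- (1)
  ( ⊩ₙ (γz 3 ∷ []) F ((S ⇒ S) ∷ [])
  × ⊩ₙ (γz 3 ∷ []) G ((Q ⇒ M) ∷ [])
  × ⊩ₙ (γz 2 ∷ []) O ((Π[ δz 3 ] (z₂ · B · A)) ∷ []) )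
  -- (2)
  × ⊢ₙ₂ ℛ (δy ∷ []) T E (‵srt ∗)
  -- (3)
  × ⊢ₙ₂ ℛ (δy ∷ []) J D (‵srt ∗)
  -- (4)
  × ( ( ⊢ₙ₂ ℛ (δy ∷ δz 2 ∷ δo ∷ []) (o · P 1 3) (z₂ · E₁ · D₁) (‵srt ∗)
      × ⊢ₙ₂ ℛ (δy ∷ δz 2 ∷ δo ∷ []) (o · P 2 3) (z₂ · E₂ · D₂) (‵srt ∗)
      × ⊢ₙ₂ ℛ (δy ∷ δz 2 ∷ δo ∷ []) (o · P 3 3) (z₂ · E₃ · D₃) (‵srt ∗) )
    × ⊢ₙ₂ ℛ (δy ∷ δz 2 ∷ δo ∷ []) (o · P 1 3 · (o · P 2 3) · (o · P 3 3)) C (‵srt ∗)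
    × ⊢ₙ₂ ℛ (δy ∷ []) V R (‵srt ∗) )
  -- (5)
  × ( ( ⊢ₙ₂ ℛ (δy ∷ δh ∷ δr ∷ []) (r · P 1 2) R₁ (‵srt ∗)
      × ⊢ₙ₂ ℛ (δy ∷ δh ∷ δr ∷ []) (r · P 2 2) R₂ (‵srt ∗) )
    × ⊢ₙ₂ ℛ (δy ∷ δh ∷ δr ∷ []) (r · P 1 2 · T) C₁ (‵srt ∗)
    × ⊢ₙ₂ ℛ (δy ∷ δh ∷ δr ∷ []) (r · P 2 2 · J) C₂ (‵srt ∗) )
  -- (6)
  × ( ⊢ₙ₂ ℛ (δy ∷ δh ∷ δr ∷ []) L y (‵srt ∗)
    × ⊢ₙ₂ ℛ (δy ∷ δh ∷ []) (Λ[ δr ] L) (Π[ δr ] y) (‵srt ∗) )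
  -- (7)
  × ⊢ₙ₂ ℛ (δy ∷ δh ∷ []) U y (‵srt ∗)
lemma3 ℛ ∗∗ □□ □∗ =
  (⊩-by-search tt , ⊩-by-search tt , ⊩-by-search tt)
  , (⊢T , ⊢E)
  , (⊢J , ⊢D)
  , ( ((⊢o·P₁₃ , ⊢z₂·E₁·D₁) , (⊢o·P₂₃ , ⊢z₂·E₂·D₂) , (⊢o·P₃₃ , ⊢z₂·E₃·D₃))
    , (⊢V-body , ⊢Cᵒ)
    , (⊢V , ⊢R) )
  , ( ((⊢r·P₁₂ , ⊢R₁) , (⊢r·P₂₂ , ⊢R₂))
    , (⊢r·P₁₂·T , ⊢C₁)
    , (⊢r·P₂₂·J , ⊢C₂) )
  , ((⊢L , ⊢yʳ) , (⊢λr·L , ⊢Πr·y))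
  , (⊢U , ⊢yʰ)
  where open Derivations ℛ ∗∗ □□ □∗
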